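{- There is an absolute constant $\alpha>0$ such that for every $c\ge1$, every property $\mathcal{P}$ of black-white $n\times n$ images that has a $c$-sparse boundary is $\delta$-earthmover resilient with $\delta(\epsilon)=\alpha\epsilon^2/c^2$ for every $\epsilon\in(0,1)$.
   Context: A black-white $n\times n$ image is a function $\mathcal{I}\colon[n]\times[n]\to\{\text{black},\text{white}\}$; two pixels are neighbors if they agree in one coordinate and differ by one in the other. The boundary of $\mathcal{I}$ is the set of black pixels having a white neighbor; it is $c$-sparse if it has at most $cn$ pixels. A property $\mathcal{P}$ (a set of images) has a $c$-sparse boundary if every image in $\mathcal{P}$ has a $c$-sparse boundary. Hamming distance: $d_H$ is the fraction of differing pixels; $\mathcal{I}$ is $\epsilon$-close to $\mathcal{P}$ if some $n\times n$ image of $\mathcal{P}$ differs from it in at most an $\epsilon$ fraction of pixels. Earthmover distance: images are identified with ordered graphs on $[2n]$ (rows $1,\dots,n$, columns $n+1,\dots,2n$; pair $\{x,n+y\}$ colored $\mathcal{I}(x,y)$, pairs of two rows or two columns colored by a special symbol); a basic move swaps two consecutive vertices of $[2n]$; $D_e$ is the minimum number of basic moves transforming one into the other ($+\infty$ if impossible) and $d_e=D_e/\binom{2n}{2}$. $\mathcal{P}$ is $\delta$-earthmover resilient if for every $\epsilon\in(0,1)$, every $\mathcal{I}\in\mathcal{P}$ and every $\mathcal{I}'$ with $d_e(\mathcal{I},\mathcal{I}')\le\delta(\epsilon)$, $\mathcal{I}'$ is $\epsilon$-close to $\mathcal{P}$.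
   Formalization: The sparsity constant c and the accuracy parameter ε range over the rationals. -}

module Defs where

open import Data.Nat.Base using (ℕ; zero; suc; _+_; _*_; _≡ᵇ_; ∣_-_∣; NonZero)
open import Data.Nat.Combinatorics using (_C_)
open import Data.Bool.Base using (Bool; true; false; _∧_; _∨_; not; if_then_else_)
open import Data.Fin.Base using (Fin; toℕ; splitAt)
open import Data.Fin.Properties using (_≟_)
open import Data.List.Base using (List; tabulate)
open import Data.Nat.ListAction using (sum)
open import Data.Bool.ListAction using (any)
open import Data.Sum.Base using (_⊎_; inj₁; inj₂)
open import Data.Product.Base using (Σ; _×_; _,_; ∃)
open import Data.Integer.Base using (+_)
open import Data.Rational.Base using (ℚ; _/_; _≤_)
open import Relation.Nullary.Decidable using (does)
open import Relation.Binary.PropositionalEquality using (_≡_)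

data Colour : Set where
  black white : Colour

isBlack : Colour → Bool
isBlack black = true
isBlack white = false

Image : ℕ → Set
Image n = Fin n → Fin n → Colour

Property : ℕ → Set₁
Property n = Image n → Set

ℕ→ℚ : ℕ → ℚ
ℕ→ℚ k = (+ k) / 1

ΣFin : (n : ℕ) → (Fin n → ℕ) → ℕ
ΣFin n f = sum (tabulate f)

countPixels : (n : ℕ) → (Fin n → Fin n → Bool) → ℕ
countPixels n p = ΣFin n (λ x → ΣFin n (λ y → if p x y then 1 else 0))

neighbours : {n : ℕ} → Fin n → Fin n → Fin n → Fin n → Bool
neighbours x y x' y' =
  (does (x ≟ x') ∧ (∣ toℕ y - toℕ y' ∣ ≡ᵇ 1)) ∨
  (does (y ≟ y') ∧ (∣ toℕ x - toℕ x' ∣ ≡ᵇ 1))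

inBoundary : {n : ℕ} → Image n → Fin n → Fin n → Bool
inBoundary {n} I x y =
  isBlack (I x y) ∧
  any (λ x' → any (λ y' → neighbours x y x' y' ∧ not (isBlack (I x' y')))
                  (tabulate {n = n} (λ y' → y')))
      (tabulate {n = n} (λ x' → x'))

boundarySize : {n : ℕ} → Image n → ℕ
boundarySize {n} I = countPixels n (inBoundary I)

SparseBoundary : {n : ℕ} → ℚ → Image n → Set
SparseBoundary {n} c I = ℕ→ℚ (boundarySize I) ≤ c Data.Rational.Base.* ℕ→ℚ n

HasSparseBoundary : {n : ℕ} → ℚ → Property n → Set
HasSparseBoundary c P = ∀ I → P I → SparseBoundary c I

differ : Colour → Colour → Bool
differ a b = not (isBlack a ≡ᵇool isBlack b)
  where
  _≡ᵇool_ : Bool → Bool → Bool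
  true  ≡ᵇool true  = true
  false ≡ᵇool false = true
  _     ≡ᵇool _     = false

hammingCount : {n : ℕ} → Image n → Image n → ℕ
hammingCount {n} I J = countPixels n (λ x y → differ (I x y) (J x y))

HammingWithin : {n : ℕ} → ℚ → Image n → Image n → Set
HammingWithin {n} ε I J = ℕ→ℚ (hammingCount I J) ≤ ε Data.Rational.Base.* ℕ→ℚ (n * n)

Close : {n : ℕ} → ℚ → Image n → Property n → Set
Close ε I P = ∃ λ J → P J × HammingWithin ε I J

data GColour : Set where
  blk wht special : GColour

toG : Colour → GColour
toG black = blk
toG white = wht

-- an (edge-coloured, complete) ordered graph on vertex set [m];
-- the colour of the pair {u , v} is G u v
OGraph : ℕ → Set
OGraph m = Fin m → Fin m → GColour

-- the ordered graph of an image on [2n] = [n + n]: the first n vertices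
-- are the rows, the last n the columns; pair {x , n + y} gets colour
-- I x y, pairs of two rows / two columns get the special symbol.
imageGraph : {n : ℕ} → Image n → OGraph (n + n)
imageGraph {n} I u v with splitAt n u | splitAt n v
... | inj₁ x | inj₂ y = toG (I x y)
... | inj₂ y | inj₁ x = toG (I x y)
... | _      | _      = special

swap : {m : ℕ} → Fin m → Fin m → Fin m → Fin m
swap i j u = if does (u ≟ i) then j else (if does (u ≟ j) then i else u)

basicMove : {m : ℕ} → Fin m → Fin m → OGraph m → OGraph m
basicMove i j G u v = G (swap i j u) (swap i j v)

_≈G_ : {m : ℕ} → OGraph m → OGraph m → Set
G ≈G H = ∀ u v → G u v ≡ H u v

data Moves {m : ℕ} : OGraph m → ℕ → OGraph m → Set where
  done : ∀ {G H} → G ≈G H → Moves G 0 H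
  step : ∀ {G H k} (i j : Fin m) → toℕ j ≡ suc (toℕ i) →
         Moves (basicMove i j G) k H → Moves G (suc k) H

-- d_e(I , I') ≤ δ, i.e. D_e(I , I') ≤ δ · binom(2n , 2): since D_e is the
-- minimum number of basic moves (or +∞), this holds iff some transformation
-- uses k moves with k ≤ δ · binom(2n , 2).
EarthmoverWithin : {n : ℕ} → ℚ → Image n → Image n → Set
EarthmoverWithin {n} δ I I' =
  ∃ λ k → Moves (imageGraph I) k (imageGraph I') ×
          ℕ→ℚ k ≤ δ Data.Rational.Base.* ℕ→ℚ ((n + n) C 2)

EarthmoverResilient : {n : ℕ} → (ℚ → ℚ) → Property n → Set
EarthmoverResilient {n} δ P =
  ∀ (ε : ℚ) → 0ℚ' < ε → ε < 1ℚ' →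
  ∀ (I : Image n) → P I → ∀ (I' : Image n) →
  EarthmoverWithin (δ ε) I I' → Close ε I' P
  where
  open import Data.Rational.Base using (_<_) renaming (0ℚ to 0ℚ'; 1ℚ to 1ℚ')

module Submission where

-- k basic moves permute the 2n row and column vertices with total displacement at most 2k,
-- so for t ≈ εn/18c at most 2k/(t+1) of them move farther than t, spoiling at most n pixels
-- each. Every other pixel (x, y) of the new image is a copy of a pixel (x′, y′) of the old one
-- with |x − x′|, |y − y′| ≤ t (or y < t: at most nt pixels). The colour can change from
-- (x, y) to (x′, y′) only across colour changes within distance t along column y and along
-- row x′, and each colour change touches a boundary pixel; summed over all pixels this costs
-- at most 8t times the boundary, i.e. 8tcn. With δ = αε²/c² the total
-- 2kn/(t+1) + nt + 8tcn is at most εn², so the original image itself witnesses closeness.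

module HammingBound where

  open import Defs
  open import Data.Nat.Base
  open import Data.Nat.Properties hiding (_≟_)
  open import Data.Fin.Base using (Fin; zero; suc; toℕ; fromℕ<; _↑ˡ_; _↑ʳ_; splitAt)
  open import Data.Fin.Properties using (_≟_; toℕ<n; toℕ-fromℕ<; fromℕ<-toℕ; toℕ-↑ˡ; toℕ-↑ʳ; splitAt-↑ˡ; splitAt-↑ʳ; splitAt⁻¹-↑ˡ; splitAt⁻¹-↑ʳ)
  open import Data.Fin.Permutation using (Permutation′; _⟨$⟩ʳ_; id; transpose; _∘ₚ_)
  import Data.Fin.Permutation.Components as Components
  open import Data.Bool.Base using (Bool; true; if_then_else_; _∧_; not)
  open import Data.Bool.Properties using (∨-zeroʳ)
  open import Data.Bool.ListAction using (any)
  open import Data.List.Base using (tabulate)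
  open import Data.Sum.Base using (_⊎_; inj₁; inj₂)
  open import Data.Empty using (⊥-elim)
  open import Data.Product.Base using (Σ-syntax; _×_; _,_)
  open import Function.Base using (_∘_)
  open import Relation.Nullary using (Dec; yes; no; does; ¬_; contradiction)
  open import Relation.Nullary.Decidable using (dec-true; dec-false)
  open import Relation.Binary.PropositionalEquality
  open import Data.Nat.Solver using (module +-*-Solver)
  open import Data.Nat.Combinatorics using (_C_; nC1≡n; nCk+nC[k+1]≡[n+1]C[k+1])
  open import Algebra.Properties.Semiring.Sum +-*-semiring using (sum; ∑-distrib-+; ∑-comm; ∑-permute)

  ΣFin≡sum : ∀ n (f : Fin n → ℕ) → ΣFin n f ≡ sum f
  ΣFin≡sum zero    f = refl
  ΣFin≡sum (suc n) f = cong (f zero +_) (ΣFin≡sum n (f ∘ suc))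

  ΣFin-cong : ∀ n {f g : Fin n → ℕ} → f ≗ g → ΣFin n f ≡ ΣFin n g
  ΣFin-cong zero    f≗g = refl
  ΣFin-cong (suc n) f≗g = cong₂ _+_ (f≗g zero) (ΣFin-cong n (f≗g ∘ suc))

  ΣFin-mono-≤ : ∀ n {f g : Fin n → ℕ} → (∀ i → f i ≤ g i) → ΣFin n f ≤ ΣFin n g
  ΣFin-mono-≤ zero    f≤g = z≤n
  ΣFin-mono-≤ (suc n) f≤g = +-mono-≤ (f≤g zero) (ΣFin-mono-≤ n (f≤g ∘ suc))

  ΣFin-const : ∀ n c → ΣFin n (λ _ → c) ≡ n * c
  ΣFin-const zero    c = refl
  ΣFin-const (suc n) c = cong (c +_) (ΣFin-const n c)

  ΣFin-zero : ∀ n → ΣFin n (λ _ → 0) ≡ 0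
  ΣFin-zero n = trans (ΣFin-const n 0) (*-zeroʳ n)

  ΣFin-distribˡ-* : ∀ n c (f : Fin n → ℕ) → ΣFin n (λ i → c * f i) ≡ c * ΣFin n f
  ΣFin-distribˡ-* zero    c f = sym (*-zeroʳ c)
  ΣFin-distribˡ-* (suc n) c f =
    trans (cong (c * f zero +_) (ΣFin-distribˡ-* n c (f ∘ suc))) (sym (*-distribˡ-+ c (f zero) _))

  ΣFin-distrib-+ : ∀ n (f g : Fin n → ℕ) → ΣFin n (λ i → f i + g i) ≡ ΣFin n f + ΣFin n g
  ΣFin-distrib-+ n f g = begin
    ΣFin n (λ i → f i + g i)  ≡⟨ ΣFin≡sum n _ ⟩
    sum (λ i → f i + g i)     ≡⟨ ∑-distrib-+ f g ⟩
    sum f + sum g             ≡⟨ cong₂ _+_ (ΣFin≡sum n f) (ΣFin≡sum n g) ⟨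
    ΣFin n f + ΣFin n g       ∎
    where open ≡-Reasoning

  ΣFin-comm : ∀ m n (f : Fin m → Fin n → ℕ) →
              ΣFin m (λ i → ΣFin n (f i)) ≡ ΣFin n (λ j → ΣFin m (λ i → f i j))
  ΣFin-comm m n f = begin
    ΣFin m (λ i → ΣFin n (f i))           ≡⟨ ΣFin-cong m (λ i → ΣFin≡sum n (f i)) ⟩
    ΣFin m (λ i → sum (f i))              ≡⟨ ΣFin≡sum m _ ⟩
    sum (λ i → sum (f i))                 ≡⟨ ∑-comm f ⟩
    sum (λ j → sum (λ i → f i j))         ≡⟨ ΣFin≡sum n _ ⟨
    ΣFin n (λ j → sum (λ i → f i j))      ≡⟨ ΣFin-cong n (λ j → ΣFin≡sum m (λ i → f i j)) ⟨
    ΣFin n (λ j → ΣFin m (λ i → f i j))   ∎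
    where open ≡-Reasoning

  ΣFin-permute : ∀ n (f : Fin n → ℕ) (π : Permutation′ n) → ΣFin n f ≡ ΣFin n (f ∘ (π ⟨$⟩ʳ_))
  ΣFin-permute n f π = begin
    ΣFin n f                 ≡⟨ ΣFin≡sum n f ⟩
    sum f                    ≡⟨ ∑-permute f π ⟩
    sum (f ∘ (π ⟨$⟩ʳ_))      ≡⟨ ΣFin≡sum n _ ⟨
    ΣFin n (f ∘ (π ⟨$⟩ʳ_))   ∎
    where open ≡-Reasoning

  ΣFin-splitAt : ∀ m n (f : Fin (m + n) → ℕ) →
                 ΣFin (m + n) f ≡ ΣFin m (f ∘ (_↑ˡ n)) + ΣFin n (f ∘ (m ↑ʳ_))
  ΣFin-splitAt zero    n f = refl
  ΣFin-splitAt (suc m) n f =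
    trans (cong (f zero +_) (ΣFin-splitAt m n (f ∘ suc))) (sym (+-assoc (f zero) _ _))

  ΣFin-indicator : ∀ n (i : Fin n) → ΣFin n (λ w → if does (w ≟ i) then 1 else 0) ≡ 1
  ΣFin-indicator (suc n) zero    = cong suc (ΣFin-zero n)
  ΣFin-indicator (suc n) (suc i) = ΣFin-indicator n i

  ΣFin² : ∀ n → (Fin n → Fin n → ℕ) → ℕ
  ΣFin² n f = ΣFin n (λ x → ΣFin n (f x))

  ΣFin²-mono-≤ : ∀ n {f g : Fin n → Fin n → ℕ} → (∀ x y → f x y ≤ g x y) → ΣFin² n f ≤ ΣFin² n g
  ΣFin²-mono-≤ n f≤g = ΣFin-mono-≤ n (λ x → ΣFin-mono-≤ n (f≤g x))

  ΣFin²-distrib-+ : ∀ n (f g : Fin n → Fin n → ℕ) → ΣFin² n (λ x y → f x y + g x y) ≡ ΣFin² n f + ΣFin² n g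
  ΣFin²-distrib-+ n f g = trans (ΣFin-cong n (λ x → ΣFin-distrib-+ n (f x) (g x))) (ΣFin-distrib-+ n _ _)

  displacement : ∀ {m} → Permutation′ m → ℕ
  displacement {m} π = ΣFin m (λ u → ∣ toℕ (π ⟨$⟩ʳ u) - toℕ u ∣)

  displacement-id : ∀ m → displacement (id {m}) ≡ 0
  displacement-id m = trans (ΣFin-cong m (∣n-n∣≡0 ∘ toℕ)) (ΣFin-zero m)

  displacement-∘ₚ : ∀ {m} (π ρ : Permutation′ m) → displacement (π ∘ₚ ρ) ≤ displacement ρ + displacement π
  displacement-∘ₚ {m} π ρ = begin
    ΣFin m (λ u → ∣ toℕ (ρ ⟨$⟩ʳ (π ⟨$⟩ʳ u)) - toℕ u ∣)
      ≤⟨ ΣFin-mono-≤ m (λ u → ∣-∣-triangle (toℕ (ρ ⟨$⟩ʳ (π ⟨$⟩ʳ u))) (toℕ (π ⟨$⟩ʳ u)) (toℕ u)) ⟩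
    ΣFin m (λ u → ∣ toℕ (ρ ⟨$⟩ʳ (π ⟨$⟩ʳ u)) - toℕ (π ⟨$⟩ʳ u) ∣ + ∣ toℕ (π ⟨$⟩ʳ u) - toℕ u ∣)
      ≡⟨ ΣFin-distrib-+ m _ _ ⟩
    ΣFin m (λ u → ∣ toℕ (ρ ⟨$⟩ʳ (π ⟨$⟩ʳ u)) - toℕ (π ⟨$⟩ʳ u) ∣) + displacement π
      ≡⟨ cong (_+ displacement π) (ΣFin-permute m (λ w → ∣ toℕ (ρ ⟨$⟩ʳ w) - toℕ w ∣) π) ⟨
    displacement ρ + displacement π ∎
    where open ≤-Reasoning

  ∣1+n-n∣≡1 : ∀ n → ∣ suc n - n ∣ ≡ 1
  ∣1+n-n∣≡1 n = trans (m≤n⇒∣n-m∣≡n∸m (n≤1+n n)) (m+n∸n≡m 1 n)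

  ∣n-1+n∣≡1 : ∀ n → ∣ n - suc n ∣ ≡ 1
  ∣n-1+n∣≡1 n = trans (∣-∣-comm n (suc n)) (∣1+n-n∣≡1 n)

  transpose-displacement : ∀ {m} (i j : Fin m) → toℕ j ≡ suc (toℕ i) → ∀ w →
    ∣ toℕ (Components.transpose i j w) - toℕ w ∣ ≤ (if does (w ≟ i) then 1 else 0) + (if does (w ≟ j) then 1 else 0)
  transpose-displacement i j j≡1+i w with w ≟ i
  ... | yes refl = ≤-trans (≤-reflexive (trans (cong (∣_- toℕ i ∣) j≡1+i) (∣1+n-n∣≡1 (toℕ i)))) (m≤m+n 1 _)
  ... | no _ with w ≟ j
  ...   | yes refl = ≤-reflexive (trans (cong (∣ toℕ i -_∣) j≡1+i) (trans (∣-∣-comm (toℕ i) _) (∣1+n-n∣≡1 (toℕ i))))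
  ...   | no _     = ≤-reflexive (∣n-n∣≡0 (toℕ w))

  displacement-transpose : ∀ {m} (i j : Fin m) → toℕ j ≡ suc (toℕ i) → displacement (transpose i j) ≤ 2
  displacement-transpose {m} i j j≡1+i = begin
    displacement (transpose i j)
      ≤⟨ ΣFin-mono-≤ m (transpose-displacement i j j≡1+i) ⟩
    ΣFin m (λ w → (if does (w ≟ i) then 1 else 0) + (if does (w ≟ j) then 1 else 0))
      ≡⟨ ΣFin-distrib-+ m _ _ ⟩
    ΣFin m (λ w → if does (w ≟ i) then 1 else 0) + ΣFin m (λ w → if does (w ≟ j) then 1 else 0)
      ≡⟨ cong₂ _+_ (ΣFin-indicator m i) (ΣFin-indicator m j) ⟩
    2 ∎
    where open ≤-Reasoning

  Realises : ∀ {m} → Permutation′ m → OGraph m → OGraph m → Set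
  Realises π G H = ∀ u v → H u v ≡ G (π ⟨$⟩ʳ u) (π ⟨$⟩ʳ v)

  swap≗transpose : ∀ {m} (i j : Fin m) → swap i j ≗ Components.transpose i j
  swap≗transpose i j u with u ≟ i
  ... | yes _ = refl
  ... | no _ with u ≟ j
  ...   | yes _ = refl
  ...   | no _  = refl

  moves⇒permutation : ∀ {m} {G H : OGraph m} {k} → Moves G k H →
                      Σ[ π ∈ Permutation′ m ] Realises π G H × displacement π ≤ 2 * k
  moves⇒permutation {m} (done G≈H) = id , (λ u v → sym (G≈H u v)) , ≤-reflexive (displacement-id m)
  moves⇒permutation {G = G} {k = suc k} (step i j j≡1+i moves) with moves⇒permutation moves
  ... | π , realises , disp≤2k = π ∘ₚ transpose i j , realises′ , disp≤2+2k
    where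
    realises′ : Realises (π ∘ₚ transpose i j) G _
    realises′ u v = trans (realises u v) (cong₂ G (swap≗transpose i j (π ⟨$⟩ʳ u)) (swap≗transpose i j (π ⟨$⟩ʳ v)))
    disp≤2+2k : displacement (π ∘ₚ transpose i j) ≤ 2 * suc k
    disp≤2+2k = begin
      displacement (π ∘ₚ transpose i j)              ≤⟨ displacement-∘ₚ π (transpose i j) ⟩
      displacement (transpose i j) + displacement π  ≤⟨ +-mono-≤ (displacement-transpose i j j≡1+i) disp≤2k ⟩
      2 + 2 * k                                      ≡⟨ *-suc 2 k ⟨
      2 * suc k                                      ∎
      where open ≤-Reasoning

  dist : Colour → Colour → ℕ
  dist a b = if differ a b then 1 else 0

  dist-self : ∀ a → dist a a ≡ 0
  dist-self black = refl
  dist-self white = refl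

  dist-sym : ∀ a b → dist a b ≡ dist b a
  dist-sym black black = refl
  dist-sym black white = refl
  dist-sym white black = refl
  dist-sym white white = refl

  dist≤1 : ∀ a b → dist a b ≤ 1
  dist≤1 black black = z≤n
  dist≤1 black white = ≤-refl
  dist≤1 white black = ≤-refl
  dist≤1 white white = z≤n

  dist-triangle : ∀ a b c → dist a c ≤ dist a b + dist b c
  dist-triangle black black c = ≤-refl
  dist-triangle white white c = ≤-refl
  dist-triangle black white c = ≤-trans (dist≤1 black c) (m≤m+n 1 _)
  dist-triangle white black c = ≤-trans (dist≤1 white c) (m≤m+n 1 _)

  Σ< : ℕ → (ℕ → ℕ) → ℕ
  Σ< n g = ΣFin n (g ∘ toℕ)

  Σ<-cong : ∀ n {f g : ℕ → ℕ} → (∀ i → i < n → f i ≡ g i) → Σ< n f ≡ Σ< n g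
  Σ<-cong n f≡g = ΣFin-cong n (λ i → f≡g (toℕ i) (toℕ<n i))

  Σ<-mono-≤ : ∀ n {f g : ℕ → ℕ} → (∀ i → i < n → f i ≤ g i) → Σ< n f ≤ Σ< n g
  Σ<-mono-≤ n f≤g = ΣFin-mono-≤ n (λ i → f≤g (toℕ i) (toℕ<n i))

  Σ<-vanishing : ∀ n {g : ℕ → ℕ} → (∀ i → i < n → g i ≡ 0) → Σ< n g ≡ 0
  Σ<-vanishing n g≡0 = trans (Σ<-cong n g≡0) (ΣFin-zero n)

  Σ<-+ : ∀ m n (g : ℕ → ℕ) → Σ< (m + n) g ≡ Σ< m g + Σ< n (g ∘ (m +_))
  Σ<-+ zero    n g = refl
  Σ<-+ (suc m) n g = trans (cong (g 0 +_) (Σ<-+ m n (g ∘ suc))) (sym (+-assoc (g 0) _ _))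

  Σ<-suc : ∀ n (g : ℕ → ℕ) → Σ< (suc n) g ≡ Σ< n g + g n
  Σ<-suc n g = begin
    Σ< (suc n) g                ≡⟨ cong (λ m → Σ< m g) (+-comm 1 n) ⟩
    Σ< (n + 1) g                ≡⟨ Σ<-+ n 1 g ⟩
    Σ< n g + (g (n + 0) + 0)    ≡⟨ cong (λ m → Σ< n g + m) (trans (+-identityʳ _) (cong g (+-identityʳ n))) ⟩
    Σ< n g + g n                ∎
    where open ≡-Reasoning

  Σ<-prefix-≤ : ∀ {m n} (g : ℕ → ℕ) → m ≤ n → Σ< m g ≤ Σ< n g
  Σ<-prefix-≤ {m} {n} g m≤n = begin
    Σ< m g                              ≤⟨ m≤m+n (Σ< m g) _ ⟩
    Σ< m g + Σ< (n ∸ m) (g ∘ (m +_))    ≡⟨ Σ<-+ m (n ∸ m) g ⟨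
    Σ< (m + (n ∸ m)) g                  ≡⟨ cong (λ k → Σ< k g) (m+[n∸m]≡n m≤n) ⟩
    Σ< n g                              ∎
    where open ≤-Reasoning

  Σ<-shiftˡ-≤ : ∀ n j {g : ℕ → ℕ} → (∀ z → n ≤ z → g z ≡ 0) → Σ< n (g ∘ (j +_)) ≤ Σ< n g
  Σ<-shiftˡ-≤ n j {g} g≡0 = begin
    Σ< n (g ∘ (j +_))                ≤⟨ m≤n+m _ (Σ< j g) ⟩
    Σ< j g + Σ< n (g ∘ (j +_))       ≡⟨ Σ<-+ j n g ⟨
    Σ< (j + n) g                     ≡⟨ cong (λ k → Σ< k g) (+-comm j n) ⟩
    Σ< (n + j) g                     ≡⟨ Σ<-+ n j g ⟩
    Σ< n g + Σ< j (g ∘ (n +_))       ≡⟨ cong (Σ< n g +_) (Σ<-vanishing j (λ i _ → g≡0 (n + i) (m≤m+n n i))) ⟩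
    Σ< n g + 0                       ≡⟨ +-identityʳ _ ⟩
    Σ< n g                           ∎
    where open ≤-Reasoning

  Σ<-shiftʳ-≤ : ∀ n s {f g : ℕ → ℕ} → (∀ x → x < s → f x ≡ 0) → (∀ x → f (s + x) ≡ g x) → Σ< n f ≤ Σ< n g
  Σ<-shiftʳ-≤ n s {f} {g} f≡0 f∘s+≡g with s ≤? n
  ... | yes s≤n = begin
    Σ< n f                               ≡⟨ cong (λ k → Σ< k f) (m+[n∸m]≡n s≤n) ⟨
    Σ< (s + (n ∸ s)) f                   ≡⟨ Σ<-+ s (n ∸ s) f ⟩
    Σ< s f + Σ< (n ∸ s) (f ∘ (s +_))     ≡⟨ cong₂ _+_ (Σ<-vanishing s f≡0) (Σ<-cong (n ∸ s) (λ x _ → f∘s+≡g x)) ⟩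
    Σ< (n ∸ s) g                         ≤⟨ Σ<-prefix-≤ g (m∸n≤m n s) ⟩
    Σ< n g                               ∎
    where open ≤-Reasoning
  ... | no s≰n = subst (_≤ Σ< n g) (sym (Σ<-vanishing n (λ x x<n → f≡0 x (<-≤-trans x<n (<⇒≤ (≰⇒> s≰n)))))) z≤n

  Σ<-indicator-< : ∀ n t → Σ< n (λ y → if does (y <? t) then 1 else 0) ≤ t
  Σ<-indicator-< zero    t       = z≤n
  Σ<-indicator-< (suc n) zero    = ≤-reflexive (Σ<-vanishing (suc n) (λ _ _ → refl))
  Σ<-indicator-< (suc n) (suc t) = s≤s (Σ<-indicator-< n t)

  variation : ℕ → (ℕ → Colour) → ℕ → ℕ
  variation n c z = if does (suc z <? n) then dist (c z) (c (suc z)) else 0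

  variation-inside : ∀ {n} c {z} → suc z < n → variation n c z ≡ dist (c z) (c (suc z))
  variation-inside {n} c {z} 1+z<n rewrite dec-true (suc z <? n) 1+z<n = refl

  variation-outside : ∀ {n} c {z} → ¬ suc z < n → variation n c z ≡ 0
  variation-outside {n} c {z} 1+z≮n rewrite dec-false (suc z <? n) 1+z≮n = refl

  dist≤Σvariation-up : ∀ n c a d → a + d < n → dist (c a) (c (a + d)) ≤ Σ< d (λ j → variation n c (a + j))
  dist≤Σvariation-up n c a zero    _ rewrite +-identityʳ a | dist-self (c a) = z≤n
  dist≤Σvariation-up n c a (suc d) a+1+d<n = begin
    dist (c a) (c (a + suc d))
      ≤⟨ dist-triangle (c a) (c (a + d)) (c (a + suc d)) ⟩
    dist (c a) (c (a + d)) + dist (c (a + d)) (c (a + suc d))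
      ≤⟨ +-monoˡ-≤ _ (dist≤Σvariation-up n c a d (<-trans (+-monoʳ-< a (n<1+n d)) a+1+d<n)) ⟩
    Σ< d (λ j → variation n c (a + j)) + dist (c (a + d)) (c (a + suc d))
      ≡⟨ cong (Σ< d (λ j → variation n c (a + j)) +_) lastStep ⟩
    Σ< d (λ j → variation n c (a + j)) + variation n c (a + d)
      ≡⟨ Σ<-suc d (λ j → variation n c (a + j)) ⟨
    Σ< (suc d) (λ j → variation n c (a + j)) ∎
    where
    open ≤-Reasoning
    lastStep : dist (c (a + d)) (c (a + suc d)) ≡ variation n c (a + d)
    lastStep rewrite +-suc a d = sym (variation-inside c a+1+d<n)

  -- The guard keeps the truncated subtraction from charging the variation at 0 repeatedly.
  variationBelow : ℕ → (ℕ → Colour) → ℕ → ℕ → ℕ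
  variationBelow n c x j = if does (j <? x) then variation n c (x ∸ suc j) else 0

  dist≤Σvariation-down : ∀ n c x d → d ≤ x → x < n → dist (c x) (c (x ∸ d)) ≤ Σ< d (variationBelow n c x)
  dist≤Σvariation-down n c x zero    _ _ rewrite dist-self (c x) = z≤n
  dist≤Σvariation-down n c x (suc d) d<x x<n = begin
    dist (c x) (c (x ∸ suc d))
      ≤⟨ dist-triangle (c x) (c (x ∸ d)) (c (x ∸ suc d)) ⟩
    dist (c x) (c (x ∸ d)) + dist (c (x ∸ d)) (c (x ∸ suc d))
      ≤⟨ +-monoˡ-≤ _ (dist≤Σvariation-down n c x d (<⇒≤ d<x) x<n) ⟩
    Σ< d (variationBelow n c x) + dist (c (x ∸ d)) (c (x ∸ suc d))
      ≡⟨ cong (Σ< d (variationBelow n c x) +_) lastStep ⟩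
    Σ< d (variationBelow n c x) + variationBelow n c x d
      ≡⟨ Σ<-suc d (variationBelow n c x) ⟨
    Σ< (suc d) (variationBelow n c x) ∎
    where
    open ≤-Reasoning
    1+[x∸1+d]≡x∸d : suc (x ∸ suc d) ≡ x ∸ d
    1+[x∸1+d]≡x∸d = sym (+-∸-assoc 1 d<x)
    lastStep : dist (c (x ∸ d)) (c (x ∸ suc d)) ≡ variationBelow n c x d
    lastStep rewrite dec-true (d <? x) d<x
               | variation-inside c (subst (_< n) (sym 1+[x∸1+d]≡x∸d) (≤-<-trans (m∸n≤m x d) x<n))
               | 1+[x∸1+d]≡x∸d = dist-sym (c (x ∸ d)) (c (x ∸ suc d))

  window : ℕ → ℕ → (ℕ → Colour) → ℕ → ℕ
  window n t c x = Σ< t (λ j → variation n c (x + j) + variationBelow n c x j)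

  dist≤window : ∀ n t c {x x′} → x < n → x′ < n → ∣ x - x′ ∣ ≤ t → dist (c x) (c x′) ≤ window n t c x
  dist≤window n t c {x} {x′} x<n x′<n ∣x-x′∣≤t with ≤-total x x′
  ... | inj₁ x≤x′ = begin
    dist (c x) (c x′)
      ≡⟨ cong (dist (c x) ∘ c) (m+[n∸m]≡n x≤x′) ⟨
    dist (c x) (c (x + (x′ ∸ x)))
      ≤⟨ dist≤Σvariation-up n c x (x′ ∸ x) (subst (_< n) (sym (m+[n∸m]≡n x≤x′)) x′<n) ⟩
    Σ< (x′ ∸ x) (λ j → variation n c (x + j))
      ≤⟨ Σ<-prefix-≤ (λ j → variation n c (x + j)) (subst (_≤ t) (m≤n⇒∣m-n∣≡n∸m x≤x′) ∣x-x′∣≤t) ⟩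
    Σ< t (λ j → variation n c (x + j))
      ≤⟨ Σ<-mono-≤ t (λ j _ → m≤m+n (variation n c (x + j)) (variationBelow n c x j)) ⟩
    window n t c x ∎
    where open ≤-Reasoning
  ... | inj₂ x′≤x = begin
    dist (c x) (c x′)
      ≡⟨ cong (dist (c x) ∘ c) (m∸[m∸n]≡n x′≤x) ⟨
    dist (c x) (c (x ∸ (x ∸ x′)))
      ≤⟨ dist≤Σvariation-down n c x (x ∸ x′) (m∸n≤m x x′) x<n ⟩
    Σ< (x ∸ x′) (variationBelow n c x)
      ≤⟨ Σ<-prefix-≤ (variationBelow n c x) (subst (_≤ t) (m≤n⇒∣n-m∣≡n∸m x′≤x) ∣x-x′∣≤t) ⟩
    Σ< t (variationBelow n c x)
      ≤⟨ Σ<-mono-≤ t (λ j _ → m≤n+m (variationBelow n c x j) (variation n c (x + j))) ⟩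
    window n t c x ∎
    where open ≤-Reasoning

  Σwindow≤ : ∀ n t c → Σ< n (window n t c) ≤ t * (2 * Σ< n (variation n c))
  Σwindow≤ n t c = begin
    Σ< n (window n t c)
      ≡⟨ ΣFin-comm n t (λ x j → variation n c (toℕ x + toℕ j) + variationBelow n c (toℕ x) (toℕ j)) ⟩
    Σ< t (λ j → Σ< n (λ x → variation n c (x + j) + variationBelow n c x j))
      ≤⟨ Σ<-mono-≤ t (λ j _ → Σvariation-shifts j) ⟩
    Σ< t (λ _ → 2 * V)
      ≡⟨ ΣFin-const t (2 * V) ⟩
    t * (2 * V) ∎
    where
    open ≤-Reasoning
    V = Σ< n (variation n c)
    Σvariation-shifts : ∀ j → Σ< n (λ x → variation n c (x + j) + variationBelow n c x j) ≤ 2 * V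
    Σvariation-shifts j = begin
      Σ< n (λ x → variation n c (x + j) + variationBelow n c x j)
        ≡⟨ ΣFin-distrib-+ n _ _ ⟩
      Σ< n (λ x → variation n c (x + j)) + Σ< n (λ x → variationBelow n c x j)
        ≤⟨ +-mono-≤ up down ⟩
      V + V
        ≡⟨ cong (V +_) (+-identityʳ V) ⟨
      2 * V ∎
      where
      up : Σ< n (λ x → variation n c (x + j)) ≤ V
      up = ≤-trans (≤-reflexive (Σ<-cong n (λ x _ → cong (variation n c) (+-comm x j))))
                   (Σ<-shiftˡ-≤ n j (λ z n≤z → variation-outside c (λ 1+z<n → <-irrefl refl (<-≤-trans (<-trans (n<1+n z) 1+z<n) n≤z))))
      down : Σ< n (λ x → variationBelow n c x j) ≤ V
      down = Σ<-shiftʳ-≤ n (suc j) below above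
        where
        below : ∀ x → x < suc j → variationBelow n c x j ≡ 0
        below x x<1+j rewrite dec-false (j <? x) (≤⇒≯ (s≤s⁻¹ x<1+j)) = refl
        above : ∀ x → variationBelow n c (suc j + x) j ≡ variation n c x
        above x rewrite dec-true (j <? suc j + x) (s≤s (m≤m+n j x)) = cong (variation n c) (m+n∸m≡n (suc j) x)

  ΣΣwindow≤ : ∀ n t (c : Fin n → ℕ → Colour) →
              ΣFin n (λ i → Σ< n (window n t (c i))) ≤ t * (2 * ΣFin n (λ i → Σ< n (variation n (c i))))
  ΣΣwindow≤ n t c = begin
    ΣFin n (λ i → Σ< n (window n t (c i)))              ≤⟨ ΣFin-mono-≤ n (λ i → Σwindow≤ n t (c i)) ⟩
    ΣFin n (λ i → t * (2 * Σ< n (variation n (c i))))   ≡⟨ ΣFin-distribˡ-* n t _ ⟩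
    t * ΣFin n (λ i → 2 * Σ< n (variation n (c i)))     ≡⟨ cong (t *_) (ΣFin-distribˡ-* n 2 _) ⟩
    t * (2 * ΣFin n (λ i → Σ< n (variation n (c i))))   ∎
    where open ≤-Reasoning

  extend : ∀ {n} {A : Set} → (Fin n → A) → A → ℕ → A
  extend {n} f d z with z <? n
  ... | yes z<n = f (fromℕ< z<n)
  ... | no _    = d

  extend-fromℕ< : ∀ {n} {A : Set} (f : Fin n → A) d {z} (z<n : z < n) → extend f d z ≡ f (fromℕ< z<n)
  extend-fromℕ< {n} f d {z} z<n with z <? n
  ... | yes _   = refl
  ... | no z≮n  = contradiction z<n z≮n

  extend-toℕ : ∀ {n} {A : Set} (f : Fin n → A) d (i : Fin n) → extend f d (toℕ i) ≡ f i
  extend-toℕ f d i = trans (extend-fromℕ< f d (toℕ<n i)) (cong f (fromℕ<-toℕ i (toℕ<n i)))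

  extend-outside : ∀ {n} {A : Set} (f : Fin n → A) d {z} → n ≤ z → extend f d z ≡ d
  extend-outside {n} f d {z} n≤z with z <? n
  ... | yes z<n = contradiction n≤z (<⇒≱ z<n)
  ... | no _    = refl

  Σvariation≤2Σ : ∀ n (c : Fin n → Colour) (β : Fin n → ℕ) →
                  (∀ i j → toℕ j ≡ suc (toℕ i) → dist (c i) (c j) ≤ β i + β j) →
                  Σ< n (variation n (extend c white)) ≤ 2 * ΣFin n β
  Σvariation≤2Σ n c β adjacent = begin
    Σ< n (variation n (extend c white))
      ≤⟨ Σ<-mono-≤ n (λ z _ → variation≤ z (suc z <? n)) ⟩
    Σ< n (λ z → β̂ z + β̂ (suc z))
      ≡⟨ ΣFin-distrib-+ n _ _ ⟩
    Σ< n β̂ + Σ< n (β̂ ∘ suc)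
      ≤⟨ +-monoʳ-≤ (Σ< n β̂) (Σ<-shiftˡ-≤ n 1 (λ z n≤z → extend-outside β 0 n≤z)) ⟩
    Σ< n β̂ + Σ< n β̂
      ≡⟨ cong₂ _+_ Σβ̂ (trans Σβ̂ (sym (+-identityʳ _))) ⟩
    2 * ΣFin n β ∎
    where
    open ≤-Reasoning
    β̂ = extend β 0
    Σβ̂ : Σ< n β̂ ≡ ΣFin n β
    Σβ̂ = ΣFin-cong n (extend-toℕ β 0)
    variation≤ : ∀ z → Dec (suc z < n) → variation n (extend c white) z ≤ β̂ z + β̂ (suc z)
    variation≤ z (no 1+z≮n) = ≤-trans (≤-reflexive (variation-outside (extend c white) 1+z≮n)) z≤n
    variation≤ z (yes 1+z<n) = begin
      variation n (extend c white) z
        ≡⟨ variation-inside (extend c white) 1+z<n ⟩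
      dist (extend c white z) (extend c white (suc z))
        ≡⟨ cong₂ dist (extend-fromℕ< c white z<n) (extend-fromℕ< c white 1+z<n) ⟩
      dist (c (fromℕ< z<n)) (c (fromℕ< 1+z<n))
        ≤⟨ adjacent (fromℕ< z<n) (fromℕ< 1+z<n) (trans (toℕ-fromℕ< 1+z<n) (cong suc (sym (toℕ-fromℕ< z<n)))) ⟩
      β (fromℕ< z<n) + β (fromℕ< 1+z<n)
        ≡⟨ cong₂ _+_ (extend-fromℕ< β 0 z<n) (extend-fromℕ< β 0 1+z<n) ⟨
      β̂ z + β̂ (suc z) ∎
      where
      z<n : z < n
      z<n = <-trans (n<1+n z) 1+z<n

  any-tabulate : ∀ {A : Set} {m} (p : A → Bool) (g : Fin m → A) i → p (g i) ≡ true → any p (tabulate g) ≡ true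
  any-tabulate p g zero    pgi≡true rewrite pgi≡true = refl
  any-tabulate p g (suc i) pgi≡true rewrite any-tabulate p (g ∘ suc) i pgi≡true = ∨-zeroʳ (p (g zero))

  neighbours-down : ∀ {n} (x x′ y : Fin n) → toℕ x′ ≡ suc (toℕ x) → neighbours x y x′ y ≡ true
  neighbours-down x x′ y x′≡1+x
    rewrite dec-true (y ≟ y) refl | x′≡1+x | ∣n-1+n∣≡1 (toℕ x) = ∨-zeroʳ _

  neighbours-up : ∀ {n} (x x′ y : Fin n) → toℕ x′ ≡ suc (toℕ x) → neighbours x′ y x y ≡ true
  neighbours-up x x′ y x′≡1+x
    rewrite dec-true (y ≟ y) refl | x′≡1+x | ∣1+n-n∣≡1 (toℕ x) = ∨-zeroʳ _

  neighbours-right : ∀ {n} (x y y′ : Fin n) → toℕ y′ ≡ suc (toℕ y) → neighbours x y x y′ ≡ true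
  neighbours-right x y y′ y′≡1+y
    rewrite dec-true (x ≟ x) refl | y′≡1+y | ∣n-1+n∣≡1 (toℕ y) = refl

  neighbours-left : ∀ {n} (x y y′ : Fin n) → toℕ y′ ≡ suc (toℕ y) → neighbours x y′ x y ≡ true
  neighbours-left x y y′ y′≡1+y
    rewrite dec-true (x ≟ x) refl | y′≡1+y | ∣1+n-n∣≡1 (toℕ y) = refl

  rowColours : ∀ {n} → Image n → Fin n → ℕ → Colour
  rowColours I x = extend (I x) white

  columnColours : ∀ {n} → Image n → Fin n → ℕ → Colour
  columnColours I y = extend (λ x → I x y) white

  module _ {n} (I : Image n) where

    boundaryIndicator : Fin n → Fin n → ℕ
    boundaryIndicator x y = if inBoundary I x y then 1 else 0

    black-next-to-white⇒inBoundary : ∀ x y x′ y′ → neighbours x y x′ y′ ≡ true →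
                                     I x y ≡ black → I x′ y′ ≡ white → inBoundary I x y ≡ true
    black-next-to-white⇒inBoundary x y x′ y′ adjacent black≡ white≡ rewrite black≡ =
      any-tabulate _ (λ x″ → x″) x′
        (any-tabulate _ (λ y″ → y″) y′ (cong₂ (λ a b → a ∧ not (isBlack b)) adjacent white≡))

    dist≤boundaryIndicator : ∀ x y x′ y′ → neighbours x y x′ y′ ≡ true → neighbours x′ y′ x y ≡ true →
                             dist (I x y) (I x′ y′) ≤ boundaryIndicator x y + boundaryIndicator x′ y′
    dist≤boundaryIndicator x y x′ y′ adjacent adjacent′ = byColours (I x y) (I x′ y′) refl refl
      where
      inBoundary⇒1 : ∀ {p q} → inBoundary I p q ≡ true → boundaryIndicator p q ≡ 1
      inBoundary⇒1 inB = cong (if_then 1 else 0) inB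
      byColours : ∀ a b → I x y ≡ a → I x′ y′ ≡ b →
                  dist a b ≤ boundaryIndicator x y + boundaryIndicator x′ y′
      byColours black black _ _ = z≤n
      byColours white white _ _ = z≤n
      byColours black white eq eq′ = ≤-trans (≤-reflexive (sym (inBoundary⇒1
        (black-next-to-white⇒inBoundary x y x′ y′ adjacent eq eq′)))) (m≤m+n _ _)
      byColours white black eq eq′ = ≤-trans (≤-reflexive (sym (inBoundary⇒1
        (black-next-to-white⇒inBoundary x′ y′ x y adjacent′ eq′ eq)))) (m≤n+m _ _)

    Σvariation-rows≤ : ΣFin n (λ x → Σ< n (variation n (rowColours I x))) ≤ 2 * boundarySize I
    Σvariation-rows≤ = begin
      ΣFin n (λ x → Σ< n (variation n (rowColours I x)))
        ≤⟨ ΣFin-mono-≤ n (λ x → Σvariation≤2Σ n (I x) (boundaryIndicator x) (λ y y′ y′≡1+y →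
             dist≤boundaryIndicator x y x y′ (neighbours-right x y y′ y′≡1+y) (neighbours-left x y y′ y′≡1+y))) ⟩
      ΣFin n (λ x → 2 * ΣFin n (boundaryIndicator x))
        ≡⟨ ΣFin-distribˡ-* n 2 _ ⟩
      2 * boundarySize I ∎
      where open ≤-Reasoning

    Σvariation-columns≤ : ΣFin n (λ y → Σ< n (variation n (columnColours I y))) ≤ 2 * boundarySize I
    Σvariation-columns≤ = begin
      ΣFin n (λ y → Σ< n (variation n (columnColours I y)))
        ≤⟨ ΣFin-mono-≤ n (λ y → Σvariation≤2Σ n (λ x → I x y) (λ x → boundaryIndicator x y) (λ x x′ x′≡1+x →
             dist≤boundaryIndicator x y x′ y (neighbours-down x x′ y x′≡1+x) (neighbours-up x x′ y x′≡1+x))) ⟩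
      ΣFin n (λ y → 2 * ΣFin n (λ x → boundaryIndicator x y))
        ≡⟨ ΣFin-distribˡ-* n 2 _ ⟩
      2 * ΣFin n (λ y → ΣFin n (λ x → boundaryIndicator x y))
        ≡⟨ cong (2 *_) (ΣFin-comm n n boundaryIndicator) ⟨
      2 * boundarySize I ∎
      where open ≤-Reasoning

  cell : ∀ {n} → Image n → Fin n ⊎ Fin n → Fin n ⊎ Fin n → GColour
  cell J (inj₁ x) (inj₂ y) = toG (J x y)
  cell J (inj₂ y) (inj₁ x) = toG (J x y)
  cell J (inj₁ _) (inj₁ _) = special
  cell J (inj₂ _) (inj₂ _) = special

  imageGraph≡cell : ∀ {n} (J : Image n) u v → imageGraph J u v ≡ cell J (splitAt n u) (splitAt n v)
  imageGraph≡cell {n} J u v with splitAt n u | splitAt n v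
  ... | inj₁ _ | inj₁ _ = refl
  ... | inj₁ _ | inj₂ _ = refl
  ... | inj₂ _ | inj₁ _ = refl
  ... | inj₂ _ | inj₂ _ = refl

  toG-injective : ∀ {a b} → toG a ≡ toG b → a ≡ b
  toG-injective {black} {black} _ = refl
  toG-injective {white} {white} _ = refl
  toG-injective {black} {white} ()
  toG-injective {white} {black} ()

  toG≢special : ∀ {a} → toG a ≢ special
  toG≢special {black} ()
  toG≢special {white} ()

  module Displaced {n} (I I′ : Image n) (π : Permutation′ (n + n))
                   (realises : Realises π (imageGraph I) (imageGraph I′)) (t : ℕ) where

    row column : Fin n → Fin (n + n)
    row x    = x ↑ˡ n
    column y = n ↑ʳ y

    moved : Fin (n + n) → ℕ
    moved u = ∣ toℕ (π ⟨$⟩ʳ u) - toℕ u ∣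

    far : Fin (n + n) → ℕ
    far u = if does (t <? moved u) then 1 else 0

    short : Fin n → ℕ
    short y = if does (toℕ y <? t) then 1 else 0

    columnWindow : Fin n → Fin n → ℕ
    columnWindow x y = window n t (columnColours I y) (toℕ x)

    rowWindowAt : Fin n ⊎ Fin n → Fin n → ℕ
    rowWindowAt (inj₁ x′) y = window n t (rowColours I x′) (toℕ y)
    rowWindowAt (inj₂ _)  _ = 0

    rowWindow : Fin n → Fin n → ℕ
    rowWindow x = rowWindowAt (splitAt n (π ⟨$⟩ʳ row x))

    nearCost : Fin n → Fin n → ℕ
    nearCost x y = short y + (columnWindow x y + rowWindow x y)

    -- A pixel on a row or column vertex moved farther than t is charged 1 by far; a column vertex
    -- moved into the row block forces y < t; otherwise the pixel copies one within distance t.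
    cost : Fin n → Fin n → ℕ
    cost x y = far (row x) + far (column y) + nearCost x y

    copied : ∀ x y → toG (I′ x y) ≡ cell I (splitAt n (π ⟨$⟩ʳ row x)) (splitAt n (π ⟨$⟩ʳ column y))
    copied x y = begin
      toG (I′ x y)                                        ≡⟨ cong₂ (cell I′) (splitAt-↑ˡ n x n) (splitAt-↑ʳ n n y) ⟨
      cell I′ (splitAt n (row x)) (splitAt n (column y))  ≡⟨ imageGraph≡cell I′ (row x) (column y) ⟨
      imageGraph I′ (row x) (column y)                    ≡⟨ realises (row x) (column y) ⟩
      imageGraph I (π ⟨$⟩ʳ row x) (π ⟨$⟩ʳ column y)       ≡⟨ imageGraph≡cell I _ _ ⟩
      cell I (splitAt n (π ⟨$⟩ʳ row x)) (splitAt n (π ⟨$⟩ʳ column y)) ∎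
      where open ≡-Reasoning

    copied-from-nearby : ∀ x y x′ y′ → splitAt n (π ⟨$⟩ʳ row x) ≡ inj₁ x′ → splitAt n (π ⟨$⟩ʳ column y) ≡ inj₂ y′ →
                         moved (row x) ≤ t → moved (column y) ≤ t →
                         dist (I′ x y) (I x y) ≤ columnWindow x y + rowWindowAt (inj₁ x′) y
    copied-from-nearby x y x′ y′ πrow πcolumn row≤t column≤t = begin
      dist (I′ x y) (I x y)
        ≡⟨ cong (λ a → dist a (I x y)) I′xy≡Ix′y′ ⟩
      dist (I x′ y′) (I x y)
        ≡⟨ dist-sym (I x′ y′) (I x y) ⟩
      dist (I x y) (I x′ y′)
        ≤⟨ dist-triangle (I x y) (I x′ y) (I x′ y′) ⟩
      dist (I x y) (I x′ y) + dist (I x′ y) (I x′ y′)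
        ≡⟨ cong₂ _+_ (cong₂ dist (extend-toℕ (λ z → I z y) white x) (extend-toℕ (λ z → I z y) white x′))
                     (cong₂ dist (extend-toℕ (I x′) white y) (extend-toℕ (I x′) white y′)) ⟨
      dist (columnColours I y (toℕ x)) (columnColours I y (toℕ x′)) + dist (rowColours I x′ (toℕ y)) (rowColours I x′ (toℕ y′))
        ≤⟨ +-mono-≤ (dist≤window n t (columnColours I y) (toℕ<n x) (toℕ<n x′) ∣x-x′∣≤t)
                    (dist≤window n t (rowColours I x′) (toℕ<n y) (toℕ<n y′) ∣y-y′∣≤t) ⟩
      columnWindow x y + rowWindowAt (inj₁ x′) y ∎
      where
      open ≤-Reasoning
      I′xy≡Ix′y′ : I′ x y ≡ I x′ y′
      I′xy≡Ix′y′ = toG-injective (trans (copied x y) (cong₂ (cell I) πrow πcolumn))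
      ∣x-x′∣≤t : ∣ toℕ x - toℕ x′ ∣ ≤ t
      ∣x-x′∣≤t = subst (_≤ t) moved≡ row≤t
        where
        moved≡ : moved (row x) ≡ ∣ toℕ x - toℕ x′ ∣
        moved≡ = begin-equality
          ∣ toℕ (π ⟨$⟩ʳ row x) - toℕ (row x) ∣  ≡⟨ cong₂ (λ p q → ∣ toℕ p - q ∣) (sym (splitAt⁻¹-↑ˡ πrow)) (toℕ-↑ˡ x n) ⟩
          ∣ toℕ (x′ ↑ˡ n) - toℕ x ∣            ≡⟨ cong (∣_- toℕ x ∣) (toℕ-↑ˡ x′ n) ⟩
          ∣ toℕ x′ - toℕ x ∣                   ≡⟨ ∣-∣-comm (toℕ x′) (toℕ x) ⟩
          ∣ toℕ x - toℕ x′ ∣                   ∎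
      ∣y-y′∣≤t : ∣ toℕ y - toℕ y′ ∣ ≤ t
      ∣y-y′∣≤t = subst (_≤ t) moved≡ column≤t
        where
        moved≡ : moved (column y) ≡ ∣ toℕ y - toℕ y′ ∣
        moved≡ = begin-equality
          ∣ toℕ (π ⟨$⟩ʳ column y) - toℕ (column y) ∣  ≡⟨ cong₂ (λ p q → ∣ toℕ p - q ∣) (sym (splitAt⁻¹-↑ʳ πcolumn)) (toℕ-↑ʳ n y) ⟩
          ∣ toℕ (n ↑ʳ y′) - (n + toℕ y) ∣            ≡⟨ cong (∣_- n + toℕ y ∣) (toℕ-↑ʳ n y′) ⟩
          ∣ n + toℕ y′ - n + toℕ y ∣                 ≡⟨ ∣m+n-m+o∣≡∣n-o∣ n (toℕ y′) (toℕ y) ⟩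
          ∣ toℕ y′ - toℕ y ∣                         ≡⟨ ∣-∣-comm (toℕ y′) (toℕ y) ⟩
          ∣ toℕ y - toℕ y′ ∣                         ∎

    column-to-row⇒short : ∀ y x″ → splitAt n (π ⟨$⟩ʳ column y) ≡ inj₁ x″ → moved (column y) ≤ t → toℕ y < t
    column-to-row⇒short y x″ πcolumn column≤t = +-cancelˡ-< n (toℕ y) t (begin-strict
      n + toℕ y                           ≡⟨ toℕ-↑ʳ n y ⟨
      toℕ (column y)                      ≤⟨ m≤n+∣n-m∣ (toℕ (column y)) p ⟩
      p + moved (column y)                <⟨ +-mono-<-≤ p<n column≤t ⟩
      n + t                               ∎)
      where
      open ≤-Reasoning
      p = toℕ (π ⟨$⟩ʳ column y)
      p<n : p < n
      p<n = subst (_< n) (trans (sym (toℕ-↑ˡ x″ n)) (cong toℕ (splitAt⁻¹-↑ˡ πcolumn))) (toℕ<n x″)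

    dist≤nearCost : ∀ x y → moved (row x) ≤ t → moved (column y) ≤ t → dist (I′ x y) (I x y) ≤ nearCost x y
    dist≤nearCost x y row≤t column≤t
      with splitAt n (π ⟨$⟩ʳ row x) in πrow | splitAt n (π ⟨$⟩ʳ column y) in πcolumn
    ... | inj₁ x′ | inj₂ y′ = ≤-trans (copied-from-nearby x y x′ y′ πrow πcolumn row≤t column≤t) (m≤n+m _ (short y))
    ... | inj₂ _  | inj₁ x″ = ≤-trans (dist≤1 _ _) (≤-trans (≤-reflexive (sym short≡1)) (m≤m+n _ _))
      where
      short≡1 : short y ≡ 1
      short≡1 = cong (if_then 1 else 0) (dec-true (toℕ y <? t) (column-to-row⇒short y x″ πcolumn column≤t))
    ... | inj₁ _  | inj₁ _  = ⊥-elim (toG≢special (trans (copied x y) (cong₂ (cell I) πrow πcolumn)))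
    ... | inj₂ _  | inj₂ _  = ⊥-elim (toG≢special (trans (copied x y) (cong₂ (cell I) πrow πcolumn)))

    far≡1 : ∀ {u} → t < moved u → far u ≡ 1
    far≡1 {u} t<moved = cong (if_then 1 else 0) (dec-true (t <? moved u) t<moved)

    dist≤cost : ∀ x y → dist (I′ x y) (I x y) ≤ cost x y
    dist≤cost x y with t <? moved (row x) | t <? moved (column y)
    ... | yes far-row | _ = begin
      dist (I′ x y) (I x y)                  ≤⟨ dist≤1 _ _ ⟩
      1                                      ≡⟨ far≡1 far-row ⟨
      far (row x)                            ≤⟨ m≤m+n _ _ ⟩
      far (row x) + far (column y)           ≤⟨ m≤m+n _ _ ⟩
      cost x y                               ∎
      where open ≤-Reasoning
    ... | no _ | yes far-column = begin
      dist (I′ x y) (I x y)                  ≤⟨ dist≤1 _ _ ⟩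
      1                                      ≡⟨ far≡1 far-column ⟨
      far (column y)                         ≤⟨ m≤n+m _ _ ⟩
      far (row x) + far (column y)           ≤⟨ m≤m+n _ _ ⟩
      cost x y                               ∎
      where open ≤-Reasoning
    ... | no near-row | no near-column =
      ≤-trans (dist≤nearCost x y (≮⇒≥ near-row) (≮⇒≥ near-column)) (m≤n+m (nearCost x y) (far (row x) + far (column y)))

    farCount : ℕ
    farCount = ΣFin (n + n) far

    [1+t]*farCount≤displacement : suc t * farCount ≤ displacement π
    [1+t]*farCount≤displacement = begin
      suc t * farCount                  ≡⟨ ΣFin-distribˡ-* (n + n) (suc t) far ⟨
      ΣFin (n + n) (λ u → suc t * far u) ≤⟨ ΣFin-mono-≤ (n + n) [1+t]*far≤moved ⟩
      displacement π                    ∎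
      where
      open ≤-Reasoning
      [1+t]*far≤moved : ∀ u → suc t * far u ≤ moved u
      [1+t]*far≤moved u with t <? moved u
      ... | yes t<moved rewrite far≡1 t<moved = ≤-trans (≤-reflexive (*-identityʳ (suc t))) t<moved
      ... | no t≮moved rewrite dec-false (t <? moved u) t≮moved | *-zeroʳ t = z≤n

    Σfar≡n*farCount : ΣFin² n (λ x y → far (row x) + far (column y)) ≡ n * farCount
    Σfar≡n*farCount = begin
      ΣFin² n (λ x y → far (row x) + far (column y))
        ≡⟨ ΣFin²-distrib-+ n _ _ ⟩
      ΣFin n (λ x → ΣFin n (λ _ → far (row x))) + ΣFin n (λ _ → ΣFin n (far ∘ column))
        ≡⟨ cong₂ _+_ (trans (ΣFin-cong n (λ x → ΣFin-const n (far (row x)))) (ΣFin-distribˡ-* n n _)) (ΣFin-const n _) ⟩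
      n * ΣFin n (far ∘ row) + n * ΣFin n (far ∘ column)
        ≡⟨ *-distribˡ-+ n _ _ ⟨
      n * (ΣFin n (far ∘ row) + ΣFin n (far ∘ column))
        ≡⟨ cong (n *_) (ΣFin-splitAt n n far) ⟨
      n * farCount ∎
      where open ≡-Reasoning

    Σshort≤ : ΣFin² n (λ _ y → short y) ≤ n * t
    Σshort≤ = ≤-trans (≤-reflexive (ΣFin-const n (ΣFin n short))) (*-monoʳ-≤ n (Σ<-indicator-< n t))

    ΣcolumnWindow≤ : ΣFin² n columnWindow ≤ t * (2 * (2 * boundarySize I))
    ΣcolumnWindow≤ = begin
      ΣFin² n columnWindow
        ≡⟨ ΣFin-comm n n columnWindow ⟩
      ΣFin n (λ y → Σ< n (window n t (columnColours I y)))
        ≤⟨ ΣΣwindow≤ n t (columnColours I) ⟩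
      t * (2 * ΣFin n (λ y → Σ< n (variation n (columnColours I y))))
        ≤⟨ *-monoʳ-≤ t (*-monoʳ-≤ 2 (Σvariation-columns≤ I)) ⟩
      t * (2 * (2 * boundarySize I)) ∎
      where open ≤-Reasoning

    ΣrowWindow≤ : ΣFin² n rowWindow ≤ t * (2 * (2 * boundarySize I))
    ΣrowWindow≤ = begin
      ΣFin n (R ∘ (π ⟨$⟩ʳ_) ∘ row)
        ≤⟨ m≤m+n _ _ ⟩
      ΣFin n (R ∘ (π ⟨$⟩ʳ_) ∘ row) + ΣFin n (R ∘ (π ⟨$⟩ʳ_) ∘ column)
        ≡⟨ ΣFin-splitAt n n (R ∘ (π ⟨$⟩ʳ_)) ⟨
      ΣFin (n + n) (R ∘ (π ⟨$⟩ʳ_))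
        ≡⟨ ΣFin-permute (n + n) R π ⟨
      ΣFin (n + n) R
        ≡⟨ ΣFin-splitAt n n R ⟩
      ΣFin n (R ∘ row) + ΣFin n (R ∘ column)
        ≡⟨ cong₂ _+_ (ΣFin-cong n (λ x → cong (λ s → ΣFin n (rowWindowAt s)) (splitAt-↑ˡ n x n)))
                     (trans (ΣFin-cong n (λ y → trans (cong (λ s → ΣFin n (rowWindowAt s)) (splitAt-↑ʳ n n y)) (ΣFin-zero n))) (ΣFin-zero n)) ⟩
      ΣFin n (λ x → Σ< n (window n t (rowColours I x))) + 0
        ≡⟨ +-identityʳ _ ⟩
      ΣFin n (λ x → Σ< n (window n t (rowColours I x)))
        ≤⟨ ΣΣwindow≤ n t (rowColours I) ⟩
      t * (2 * ΣFin n (λ x → Σ< n (variation n (rowColours I x))))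
        ≤⟨ *-monoʳ-≤ t (*-monoʳ-≤ 2 (Σvariation-rows≤ I)) ⟩
      t * (2 * (2 * boundarySize I)) ∎
      where
      open ≤-Reasoning
      R : Fin (n + n) → ℕ
      R w = ΣFin n (rowWindowAt (splitAt n w))

    hamming≤ : hammingCount I′ I ≤ n * farCount + (n * t + (t * (2 * (2 * boundarySize I)) + t * (2 * (2 * boundarySize I))))
    hamming≤ = begin
      ΣFin² n (λ x y → dist (I′ x y) (I x y))
        ≤⟨ ΣFin²-mono-≤ n dist≤cost ⟩
      ΣFin² n cost
        ≡⟨ ΣFin²-distrib-+ n _ nearCost ⟩
      ΣFin² n (λ x y → far (row x) + far (column y)) + ΣFin² n nearCost
        ≡⟨ cong (ΣFin² n (λ x y → far (row x) + far (column y)) +_)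
             (trans (ΣFin²-distrib-+ n (λ _ y → short y) _) (cong (ΣFin² n (λ _ y → short y) +_) (ΣFin²-distrib-+ n columnWindow rowWindow))) ⟩
      ΣFin² n (λ x y → far (row x) + far (column y)) + (ΣFin² n (λ _ y → short y) + (ΣFin² n columnWindow + ΣFin² n rowWindow))
        ≤⟨ +-mono-≤ (≤-reflexive Σfar≡n*farCount) (+-mono-≤ Σshort≤ (+-mono-≤ ΣcolumnWindow≤ ΣrowWindow≤)) ⟩
      n * farCount + (n * t + (t * (2 * (2 * boundarySize I)) + t * (2 * (2 * boundarySize I)))) ∎
      where open ≤-Reasoning

  hamming*[1+t]≤ : ∀ {n} (I I′ : Image n) {k} → Moves (imageGraph I) k (imageGraph I′) → ∀ t →
                   hammingCount I′ I * suc t ≤ n * (2 * k) + suc t * (n * t + 8 * t * boundarySize I)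
  hamming*[1+t]≤ {n} I I′ {k} moves t with moves⇒permutation moves
  ... | π , realises , displacement≤2k = begin
    hammingCount I′ I * suc t
      ≤⟨ *-monoˡ-≤ (suc t) hamming≤ ⟩
    (n * farCount + (n * t + (t * (2 * (2 * B)) + t * (2 * (2 * B))))) * suc t
      ≡⟨ rearrange n farCount t B ⟩
    n * (suc t * farCount) + suc t * (n * t + 8 * t * B)
      ≤⟨ +-monoˡ-≤ _ (*-monoʳ-≤ n (≤-trans [1+t]*farCount≤displacement displacement≤2k)) ⟩
    n * (2 * k) + suc t * (n * t + 8 * t * B) ∎
    where
    open ≤-Reasoning
    open Displaced I I′ π realises t
    open +-*-Solver
    B = boundarySize I
    rearrange : ∀ n F t B → (n * F + (n * t + (t * (2 * (2 * B)) + t * (2 * (2 * B))))) * suc t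
                          ≡ n * (suc t * F) + suc t * (n * t + 8 * t * B)
    rearrange = solve 4 (λ n F t B → (n :* F :+ (n :* t :+ (t :* (con 2 :* (con 2 :* B)) :+ t :* (con 2 :* (con 2 :* B))))) :* (con 1 :+ t)
                                   := n :* ((con 1 :+ t) :* F) :+ (con 1 :+ t) :* (n :* t :+ con 8 :* t :* B)) refl

  mC2≤m*m : ∀ m → m C 2 ≤ m * m
  mC2≤m*m zero    = z≤n
  mC2≤m*m (suc m) = begin
    suc m C 2            ≡⟨ nCk+nC[k+1]≡[n+1]C[k+1] m 1 ⟨
    m C 1 + m C 2      ≡⟨ cong (_+ m C 2) (nC1≡n m) ⟩
    m + m C 2          ≤⟨ +-monoʳ-≤ m (mC2≤m*m m) ⟩
    m + m * m        ≤⟨ m≤n+m _ (suc m) ⟩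
    suc m + (m + m * m) ≡⟨ *-suc (suc m) m ⟨
    suc m * suc m      ∎
    where open ≤-Reasoning

module RationalArithmetic where

  open import Defs using (ℕ→ℚ)
  open import Data.Nat.Combinatorics using (_C_)
  open HammingBound using (mC2≤m*m)
  open import Data.Nat.Base as ℕ using (ℕ; suc)
  open import Data.Nat.Properties using (n<1+n)
  open import Data.Integer.Base as ℤ using (+_)
  import Data.Integer.Properties as ℤ
  open import Data.Nat.Coprimality using (1-coprimeTo; sym)
  open import Data.Rational.Base
  open import Data.Rational.Properties
  open import Data.Rational.Solver using (module +-*-Solver)
  open import Relation.Binary.PropositionalEquality using (_≡_; refl; cong; cong₂; subst; subst₂; trans) renaming (sym to ≡-sym)
  open import Data.Product.Base using (∃; _×_; _,_; map₂)
  open import Relation.Nullary using (¬_; yes; no; contradiction)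
  open import Relation.Unary using (Decidable)

  ℕ→ℚ≡mkℚ : ∀ a → ℕ→ℚ a ≡ mkℚ (+ a) 0 (sym (1-coprimeTo a))
  ℕ→ℚ≡mkℚ a = normalize-coprime {a} {0} (sym (1-coprimeTo a))

  ℕ→ℚ-+ : ∀ a b → ℕ→ℚ (a ℕ.+ b) ≡ ℕ→ℚ a + ℕ→ℚ b
  ℕ→ℚ-+ a b rewrite ℕ→ℚ≡mkℚ a | ℕ→ℚ≡mkℚ b =
    /-cong {+ (a ℕ.+ b)} {1} (trans (ℤ.pos-+ a b) (≡-sym (cong₂ ℤ._+_ (ℤ.*-identityʳ (+ a)) (ℤ.*-identityʳ (+ b))))) refl

  ℕ→ℚ-* : ∀ a b → ℕ→ℚ (a ℕ.* b) ≡ ℕ→ℚ a * ℕ→ℚ b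
  ℕ→ℚ-* a b rewrite ℕ→ℚ≡mkℚ a | ℕ→ℚ≡mkℚ b = /-cong {+ (a ℕ.* b)} {1} (ℤ.pos-* a b) refl

  ℕ→ℚ-mono-≤ : ∀ {a b} → a ℕ.≤ b → ℕ→ℚ a ≤ ℕ→ℚ b
  ℕ→ℚ-mono-≤ {a} {b} a≤b rewrite ℕ→ℚ≡mkℚ a | ℕ→ℚ≡mkℚ b =
    *≤* (subst₂ ℤ._≤_ (≡-sym (ℤ.*-identityʳ (+ a))) (≡-sym (ℤ.*-identityʳ (+ b))) (ℤ.+≤+ a≤b))

  ℕ→ℚ-mono-< : ∀ {a b} → a ℕ.< b → ℕ→ℚ a < ℕ→ℚ b
  ℕ→ℚ-mono-< {a} {b} a<b rewrite ℕ→ℚ≡mkℚ a | ℕ→ℚ≡mkℚ b =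
    *<* (subst₂ ℤ._<_ (≡-sym (ℤ.*-identityʳ (+ a))) (≡-sym (ℤ.*-identityʳ (+ b))) (ℤ.+<+ a<b))

  0≤ℕ→ℚ : ∀ a → 0ℚ ≤ ℕ→ℚ a
  0≤ℕ→ℚ a = ℕ→ℚ-mono-≤ {0} {a} ℕ.z≤n

  0<ℕ→ℚ[1+a] : ∀ a → 0ℚ < ℕ→ℚ (suc a)
  0<ℕ→ℚ[1+a] a rewrite ℕ→ℚ≡mkℚ (suc a) = *<* (ℤ.+<+ (ℕ.s≤s ℕ.z≤n))

  *-monoˡ-≤ : ∀ {p q r} → 0ℚ ≤ r → p ≤ q → r * p ≤ r * q
  *-monoˡ-≤ {r = r} 0≤r = *-monoˡ-≤-nonNeg r {{nonNegative 0≤r}}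

  *-monoʳ-≤ : ∀ {p q r} → 0ℚ ≤ r → p ≤ q → p * r ≤ q * r
  *-monoʳ-≤ {r = r} 0≤r = *-monoʳ-≤-nonNeg r {{nonNegative 0≤r}}

  0≤* : ∀ {p q} → 0ℚ ≤ p → 0ℚ ≤ q → 0ℚ ≤ p * q
  0≤* {p} {q} 0≤p 0≤q = subst (_≤ p * q) (*-zeroˡ q) (*-monoʳ-≤ 0≤q 0≤p)

  0≤1/ : ∀ c .{{_ : NonZero c}} → 0ℚ < c → 0ℚ ≤ 1/ c
  0≤1/ (mkℚ ℤ.+[1+ _ ] _ _) _                  = *≤* (ℤ.+≤+ ℕ.z≤n)
  0≤1/ (mkℚ (+ 0)      _ _) (*<* (ℤ.+<+ ()))
  0≤1/ (mkℚ ℤ.-[1+ _ ] _ _) (*<* ())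

  -- 288 = 16 · 18: 16 from (2n)² and the doubled far term, 18 from the choice of t.
  α : ℚ
  α = + 1 / 288

  0<α : 0ℚ < α
  0<α = *<* (ℤ.+<+ (ℕ.s≤s ℕ.z≤n))

  near-term : ∀ {N t b ε c} → 0ℚ ≤ N → 0ℚ ≤ t → 1ℚ ≤ c → b ≤ c * N → ℕ→ℚ 18 * c * t ≤ ε * N →
              ℕ→ℚ 2 * (N * t + ℕ→ℚ 8 * t * b) ≤ ε * N * N
  near-term {N} {t} {b} {ε} {c} 0≤N 0≤t 1≤c b≤cN 18ct≤εN = begin
    ℕ→ℚ 2 * (N * t + ℕ→ℚ 8 * t * b)
      ≤⟨ *-monoˡ-≤ (0≤ℕ→ℚ 2) (+-mono-≤ Nt≤cNt (*-monoˡ-≤ (0≤* (0≤ℕ→ℚ 8) 0≤t) b≤cN)) ⟩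
    ℕ→ℚ 2 * (c * (N * t) + ℕ→ℚ 8 * t * (c * N))
      ≡⟨ solve 3 (λ N t c → con (ℕ→ℚ 2) :* (c :* (N :* t) :+ con (ℕ→ℚ 8) :* t :* (c :* N))
                          := con (ℕ→ℚ 18) :* c :* t :* N) refl N t c ⟩
    ℕ→ℚ 18 * c * t * N
      ≤⟨ *-monoʳ-≤ 0≤N 18ct≤εN ⟩
    ε * N * N ∎
    where
    open ≤-Reasoning
    open +-*-Solver
    Nt≤cNt : N * t ≤ c * (N * t)
    Nt≤cNt = subst (_≤ c * (N * t)) (*-identityˡ (N * t)) (*-monoʳ-≤ (0≤* 0≤N 0≤t) 1≤c)

  far-term : ∀ {N k T ε c ic} → 0ℚ ≤ N → 0ℚ ≤ T → 0ℚ ≤ ε → 0ℚ ≤ ic → 1ℚ ≤ c → c * ic ≡ 1ℚ →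
             k ≤ α * (ε * ε) * ic * ic * ((N + N) * (N + N)) → ε * N ≤ ℕ→ℚ 18 * c * T →
             ℕ→ℚ 2 * (N * (ℕ→ℚ 2 * k)) ≤ ε * N * N * T
  far-term {N} {k} {T} {ε} {c} {ic} 0≤N 0≤T 0≤ε 0≤ic 1≤c c*ic≡1 k≤δN² εN≤18cT = begin
    ℕ→ℚ 2 * (N * (ℕ→ℚ 2 * k))
      ≤⟨ *-monoˡ-≤ (0≤ℕ→ℚ 2) (*-monoˡ-≤ 0≤N (*-monoˡ-≤ (0≤ℕ→ℚ 2) k≤δN²)) ⟩
    ℕ→ℚ 2 * (N * (ℕ→ℚ 2 * (α * (ε * ε) * ic * ic * ((N + N) * (N + N)))))
      ≡⟨ solve 3 (λ N ε ic → con (ℕ→ℚ 2) :* (N :* (con (ℕ→ℚ 2) :* (con α :* (ε :* ε) :* ic :* ic :* ((N :+ N) :* (N :+ N)))))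
                           := (ε :* N) :* (con (ℕ→ℚ 16) :* con α :* ε :* ic :* ic :* N :* N)) refl N ε ic ⟩
    ε * N * Z
      ≤⟨ *-monoʳ-≤ 0≤Z εN≤18cT ⟩
    ℕ→ℚ 18 * c * T * Z
      ≡⟨ solve 5 (λ c T ε ic N → con (ℕ→ℚ 18) :* c :* T :* (con (ℕ→ℚ 16) :* con α :* ε :* ic :* ic :* N :* N)
                             := ε :* N :* N :* T :* ic :* (c :* ic)) refl c T ε ic N ⟩
    ε * N * N * T * ic * (c * ic)
      ≡⟨ trans (cong (ε * N * N * T * ic *_) c*ic≡1) (*-identityʳ _) ⟩
    ε * N * N * T * ic
      ≤⟨ *-monoˡ-≤ (0≤* (0≤* (0≤* 0≤ε 0≤N) 0≤N) 0≤T) ic≤1 ⟩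
    ε * N * N * T * 1ℚ
      ≡⟨ *-identityʳ _ ⟩
    ε * N * N * T ∎
    where
    open ≤-Reasoning
    open +-*-Solver
    Z = ℕ→ℚ 16 * α * ε * ic * ic * N * N
    0≤Z : 0ℚ ≤ Z
    0≤Z = 0≤* (0≤* (0≤* (0≤* (0≤* (0≤* (0≤ℕ→ℚ 16) (<⇒≤ 0<α)) 0≤ε) 0≤ic) 0≤ic) 0≤N) 0≤N
    ic≤1 : ic ≤ 1ℚ
    ic≤1 = begin
      ic          ≡⟨ *-identityʳ ic ⟨
      ic * 1ℚ     ≤⟨ *-monoˡ-≤ 0≤ic 1≤c ⟩
      ic * c      ≡⟨ trans (*-comm ic c) c*ic≡1 ⟩
      1ℚ          ∎

  hamming-arithmetic : ∀ (h k n t b : ℕ) {ε c : ℚ} .{{_ : NonZero c}} → 0ℚ ≤ ε → 1ℚ ≤ c →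
    h ℕ.* suc t ℕ.≤ n ℕ.* (2 ℕ.* k) ℕ.+ suc t ℕ.* (n ℕ.* t ℕ.+ 8 ℕ.* t ℕ.* b) →
    ℕ→ℚ b ≤ c * ℕ→ℚ n →
    ℕ→ℚ k ≤ α * (ε * ε) ÷ c ÷ c * ℕ→ℚ ((n ℕ.+ n) C 2) →
    ℕ→ℚ 18 * c * ℕ→ℚ t ≤ ε * ℕ→ℚ n →
    ε * ℕ→ℚ n ≤ ℕ→ℚ 18 * c * ℕ→ℚ (suc t) →
    ℕ→ℚ h ≤ ε * ℕ→ℚ (n ℕ.* n)
  hamming-arithmetic h k n t b {ε} {c} 0≤ε 1≤c h[1+t]≤ b≤cn k≤δC 18ct≤εn εn≤18c[1+t] =
    subst (H ≤_) (cong (ε *_) (≡-sym (ℕ→ℚ-* n n)))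
      (*-cancelʳ-≤-pos T {{positive (0<ℕ→ℚ[1+a] t)}} (*-cancelˡ-≤-pos (ℕ→ℚ 2) {{positive (0<ℕ→ℚ[1+a] 1)}} (begin
        ℕ→ℚ 2 * (H * T)
          ≤⟨ *-monoˡ-≤ (0≤ℕ→ℚ 2) HT≤ ⟩
        ℕ→ℚ 2 * (N * (ℕ→ℚ 2 * K) + T * X)
          ≡⟨ solve 4 (λ N K T X → con (ℕ→ℚ 2) :* (N :* (con (ℕ→ℚ 2) :* K) :+ T :* X)
                                := con (ℕ→ℚ 2) :* (N :* (con (ℕ→ℚ 2) :* K)) :+ T :* (con (ℕ→ℚ 2) :* X)) refl N K T X ⟩
        ℕ→ℚ 2 * (N * (ℕ→ℚ 2 * K)) + T * (ℕ→ℚ 2 * X)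
          ≤⟨ +-mono-≤ (far-term (0≤ℕ→ℚ n) (0≤ℕ→ℚ (suc t)) 0≤ε 0≤ic 1≤c (*-inverseʳ c) K≤δN² εn≤18c[1+t])
                      (*-monoˡ-≤ (0≤ℕ→ℚ (suc t)) (near-term {ε = ε} (0≤ℕ→ℚ n) (0≤ℕ→ℚ t) 1≤c b≤cn 18ct≤εn)) ⟩
        ε * N * N * T + T * (ε * N * N)
          ≡⟨ solve 3 (λ ε N T → ε :* N :* N :* T :+ T :* (ε :* N :* N) := con (ℕ→ℚ 2) :* (ε :* (N :* N) :* T)) refl ε N T ⟩
        ℕ→ℚ 2 * (ε * (N * N) * T) ∎)))
    where
    open ≤-Reasoning
    open +-*-Solver
    H = ℕ→ℚ h
    K = ℕ→ℚ k
    N = ℕ→ℚ n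
    T = ℕ→ℚ (suc t)
    X = N * ℕ→ℚ t + ℕ→ℚ 8 * ℕ→ℚ t * ℕ→ℚ b
    0≤ic : 0ℚ ≤ 1/ c
    0≤ic = 0≤1/ c (<-≤-trans (0<ℕ→ℚ[1+a] 0) 1≤c)
    HT≤ : H * T ≤ N * (ℕ→ℚ 2 * K) + T * X
    HT≤ = subst₂ _≤_ (ℕ→ℚ-* h (suc t))
      (trans (ℕ→ℚ-+ (n ℕ.* (2 ℕ.* k)) (suc t ℕ.* (n ℕ.* t ℕ.+ 8 ℕ.* t ℕ.* b)))
        (cong₂ _+_ (trans (ℕ→ℚ-* n (2 ℕ.* k)) (cong (N *_) (ℕ→ℚ-* 2 k)))
                   (trans (ℕ→ℚ-* (suc t) (n ℕ.* t ℕ.+ 8 ℕ.* t ℕ.* b)) (cong (T *_)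
                     (trans (ℕ→ℚ-+ (n ℕ.* t) (8 ℕ.* t ℕ.* b))
                       (cong₂ _+_ (ℕ→ℚ-* n t) (trans (ℕ→ℚ-* (8 ℕ.* t) b) (cong (_* ℕ→ℚ b) (ℕ→ℚ-* 8 t)))))))))
      (ℕ→ℚ-mono-≤ h[1+t]≤)
    0≤δ : 0ℚ ≤ α * (ε * ε) * 1/ c * 1/ c
    0≤δ = 0≤* (0≤* (0≤* (<⇒≤ 0<α) (0≤* 0≤ε 0≤ε)) 0≤ic) 0≤ic
    K≤δN² : K ≤ α * (ε * ε) * 1/ c * 1/ c * ((N + N) * (N + N))
    K≤δN² = subst (λ x → K ≤ α * (ε * ε) * 1/ c * 1/ c * x)
              (trans (ℕ→ℚ-* (n ℕ.+ n) (n ℕ.+ n)) (cong₂ _*_ (ℕ→ℚ-+ n n) (ℕ→ℚ-+ n n)))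
              (≤-trans k≤δC (*-monoˡ-≤ 0≤δ (ℕ→ℚ-mono-≤ (mC2≤m*m (n ℕ.+ n)))))

  εn<18c[1+n] : ∀ n {ε c} → ε < 1ℚ → 1ℚ ≤ c → ε * ℕ→ℚ n < ℕ→ℚ 18 * c * ℕ→ℚ (suc n)
  εn<18c[1+n] n {ε} {c} ε<1 1≤c = begin-strict
    ε * ℕ→ℚ n                  ≤⟨ *-monoʳ-≤ (0≤ℕ→ℚ n) (<⇒≤ ε<1) ⟩
    1ℚ * ℕ→ℚ n                 ≡⟨ *-identityˡ (ℕ→ℚ n) ⟩
    ℕ→ℚ n                      <⟨ ℕ→ℚ-mono-< (n<1+n n) ⟩
    ℕ→ℚ (suc n)                ≡⟨ *-identityˡ (ℕ→ℚ (suc n)) ⟨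
    1ℚ * ℕ→ℚ (suc n)           ≤⟨ *-monoʳ-≤ (0≤ℕ→ℚ (suc n)) 1≤18c ⟩
    ℕ→ℚ 18 * c * ℕ→ℚ (suc n)   ∎
    where
    open ≤-Reasoning
    1≤18c : 1ℚ ≤ ℕ→ℚ 18 * c
    1≤18c = begin
      1ℚ             ≤⟨ ℕ→ℚ-mono-≤ {1} {18} (ℕ.s≤s ℕ.z≤n) ⟩
      ℕ→ℚ 18         ≡⟨ *-identityʳ (ℕ→ℚ 18) ⟨
      ℕ→ℚ 18 * 1ℚ    ≤⟨ *-monoˡ-≤ (0≤ℕ→ℚ 18) 1≤c ⟩
      ℕ→ℚ 18 * c     ∎


  crossing : ∀ {P : ℕ → Set} → Decidable P → P 0 → ∀ m → ¬ P m → ∃ λ t → P t × ¬ P (suc t)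
  crossing P? P0 ℕ.zero  ¬P0   = contradiction P0 ¬P0
  crossing P? P0 (suc m) ¬P1+m with P? m
  ... | yes Pm  = m , Pm , ¬P1+m
  ... | no  ¬Pm = crossing P? P0 m ¬Pm

  threshold : ∀ n {ε c} → 0ℚ ≤ ε → ε < 1ℚ → 1ℚ ≤ c →
              ∃ λ t → ℕ→ℚ 18 * c * ℕ→ℚ t ≤ ε * ℕ→ℚ n × ε * ℕ→ℚ n ≤ ℕ→ℚ 18 * c * ℕ→ℚ (suc t)
  threshold n {ε} {c} 0≤ε ε<1 1≤c = map₂ (map₂ (λ 18c[1+t]≰εn → <⇒≤ (≰⇒> 18c[1+t]≰εn)))
    (crossing (λ t → ℕ→ℚ 18 * c * ℕ→ℚ t ≤? ε * ℕ→ℚ n) 18c0≤εn (suc n) (λ 18c[1+n]≤εn → <-irrefl refl (<-≤-trans (εn<18c[1+n] n ε<1 1≤c) 18c[1+n]≤εn)))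
    where
    18c0≤εn : ℕ→ℚ 18 * c * ℕ→ℚ 0 ≤ ε * ℕ→ℚ n
    18c0≤εn = subst (_≤ ε * ℕ→ℚ n) (≡-sym (*-zeroʳ (ℕ→ℚ 18 * c))) (0≤* 0≤ε (0≤ℕ→ℚ n))

open import Defs
open import Data.Nat.Base using (ℕ)
open import Data.Product.Base using (∃; _×_)
open import Data.Rational.Base using (ℚ; _<_; _≤_; _*_; _÷_; 0ℚ; 1ℚ; NonZero)

import Data.Rational.Properties as ℚ
open import Data.Product.Base using (_,_)
open HammingBound using (hamming*[1+t]≤)
open RationalArithmetic using (0<α; threshold; hamming-arithmetic)

earthmover-close⇒hamming-close : ∀ (c : ℚ) .{{_ : NonZero c}} → 1ℚ ≤ c → ∀ {n} (I I′ : Image n) →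
  SparseBoundary c I → ∀ ε → 0ℚ < ε → ε < 1ℚ →
  EarthmoverWithin ((RationalArithmetic.α * (ε * ε)) ÷ c ÷ c) I I′ → HammingWithin ε I′ I
earthmover-close⇒hamming-close c 1≤c {n} I I′ sparse ε 0<ε ε<1 (k , moves , k≤δC) =
  let t , 18ct≤εn , εn≤18c[1+t] = threshold n (ℚ.<⇒≤ 0<ε) ε<1 1≤c in
  hamming-arithmetic (hammingCount I′ I) k n t (boundarySize I) (ℚ.<⇒≤ 0<ε) 1≤c
    (hamming*[1+t]≤ I I′ moves t) sparse k≤δC 18ct≤εn εn≤18c[1+t]

sparse-boundary⇒resilient : ∀ (c : ℚ) .{{_ : NonZero c}} → 1ℚ ≤ c → ∀ n (P : Property n) → HasSparseBoundary c P →
            EarthmoverResilient (λ ε → ((RationalArithmetic.α * (ε * ε)) ÷ c) ÷ c) P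
sparse-boundary⇒resilient c 1≤c n P sparse ε 0<ε ε<1 I PI I′ within =
  I , PI , earthmover-close⇒hamming-close c 1≤c I I′ (sparse I PI) ε 0<ε ε<1 within

theorem5 : ∃ λ (α : ℚ) → 0ℚ < α ×
    ((c : ℚ) → .{{_ : NonZero c}} → 1ℚ ≤ c →
      ∀ (n : ℕ) (P : Property n) → HasSparseBoundary c P →
      EarthmoverResilient (λ ε → ((α * (ε * ε)) ÷ c) ÷ c) P)
theorem5 = RationalArithmetic.α , 0<α , sparse-boundary⇒resilient
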